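{- For the process algebra TACS with type-2 clock transitions, the $2,0$-indexed faster-than preorder $\stackrel{\sqsupset}{\sim}_{2,0}$ is contained in the 2-naive faster-than preorder $\sqsupseteq_{2\text{ -nv}}$, but the reverse inclusion fails. For example, with $P = \tau.\mathbf{0}\,|\,\sigma.\sigma.\tau.\mathbf{0}$ and $Q = \sigma.\tau.\mathbf{0}\,|\,\sigma.\sigma.\tau.\mathbf{0}$, we have $P \sqsupseteq_{2\text{ -nv}} Q$ but not $P \stackrel{\sqsupset}{\sim}_{2,0} Q$.
   Context: TACS extends CCS (processes built from $\mathbf{0}$, action prefix $\alpha.P$, choice $+$, parallel composition $|$, restriction, relabelling, guarded recursion $\mu x.P$) with a clock prefix $\sigma.P$ meaning a delay of at most one time unit. Action transitions $P \xrightarrow{\alpha} P'$ are as in CCS plus the rule that $\sigma.P \xrightarrow{\alpha} P'$ whenever $P \xrightarrow{\alpha} P'$. $\mathcal{U}(P)$ denotes the set of urgent actions of $P$ (initial actions not delayed by a $\sigma$-prefix; for $P|Q$ it contains $\tau$ if $P$ and $Q$ have complementary urgent actions). Type-2 clock transitions $\xrightarrow{\sigma}_2$ are given by: $\mathbf{0}\xrightarrow{\sigma}_2\mathbf{0}$; $a.P\xrightarrow{\sigma}_2 a.P$ for visible $a$; $\sigma.P\xrightarrow{\sigma}_2 P$; $\sigma.P\xrightarrow{\sigma}_2 P'$ if $P\xrightarrow{\sigma}_2 P'$; sums and restrictions/relabellings/recursion step componentwise; and $P|Q\xrightarrow{\sigma}_2 P'|Q'$ if $P\xrightarrow{\sigma}_2P'$,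 $Q\xrightarrow{\sigma}_2Q'$ and $\tau\notin\mathcal{U}(P|Q)$ (so no time step is possible with an urgent $\tau$; $\tau.P$ has no time step). A relation $\mathcal{R}$ on processes is a 2-naive faster-than relation if for $(P,Q)\in\mathcal{R}$: every $P\xrightarrow{\alpha}P'$ is matched by some $Q\xrightarrow{\alpha}Q'$ with $(P',Q')\in\mathcal{R}$, every $Q\xrightarrow{\alpha}Q'$ is matched by some $P\xrightarrow{\alpha}P'$ with $(P',Q')\in\mathcal{R}$, and every $P\xrightarrow{\sigma}_2P'$ is matched by some $Q\xrightarrow{\sigma}_2Q'$ with $(P',Q')\in\mathcal{R}$; $\sqsupseteq_{2\text{ -nv}}$ is the union of all such relations. A family $(\mathcal{R}_j)_{j\in\mathbb{N}}$ is a family of 2-indexed faster-than relations if for all $j$ and $(P,Q)\in\mathcal{R}_j$: actions are matched bisimulation-style within $\mathcal{R}_j$ (both directions); $P\xrightarrow{\sigma}_2P'$ implies (a) some $Q\xrightarrow{\sigma}_2Q'$ with $(P',Q')\in\mathcal{R}_j$, or (b) $j>0$ and $(P',Q)\in\mathcal{R}_{j-1}$; and $Q\xrightarrow{\sigma}_2Q'$ implies (a) some $P\xrightarrow{\sigma}_2P'$ with $(P',Q')\in\mathcal{R}_j$, or (b) $(P,Q')\in\mathcal{R}_{j+1}$. $P\stackrel{\sqsupset}{\sim}_{2,j}Q$ means $(P,Q)\in\mathcal{R}_j$ for some such family. -}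

module Defs where

open import Level using (0ℓ)
open import Data.Nat using (ℕ; zero; suc; _≡ᵇ_)
open import Data.Bool using (if_then_else_)
open import Data.List using (List)
open import Data.List.Membership.Propositional using (_∈_)
open import Data.Unit using (⊤)
open import Data.Product using (Σ; _×_; ∃)
open import Relation.Nullary using (¬_)
open import Relation.Binary using (Rel)
open import Data.Sum using (_⊎_)
open import Relation.Binary.PropositionalEquality using (_≡_)

Name : Set
Name = ℕ

Var : Set
Var = ℕ

data Act : Set where
  τ   : Act
  inp : Name → Act
  out : Name → Act

-- Complementation on actions (τ is self-complementary; not used for τ).
compl : Act → Act
compl τ       = τ
compl (inp a) = out a
compl (out a) = inp a

data Visible : Act → Set where
  vis-inp : ∀ a → Visible (inp a)
  vis-out : ∀ a → Visible (out a)

-- Relabelling functions f : Name → Name, lifted to actions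
-- (so f(τ)=τ and f(ā) = complement of f(a) hold by construction).
relab : (Name → Name) → Act → Act
relab f τ       = τ
relab f (inp a) = inp (f a)
relab f (out a) = out (f a)

Allowed : List Name → Act → Set
Allowed L τ       = ⊤
Allowed L (inp a) = ¬ (a ∈ L)
Allowed L (out a) = ¬ (a ∈ L)

data Proc : Set where
  nil  : Proc
  act  : Act → Proc → Proc
  clk  : Proc → Proc
  _⊕_  : Proc → Proc → Proc
  _∥_  : Proc → Proc → Proc
  res  : Proc → List Name → Proc
  rel  : Proc → (Name → Name) → Proc
  var  : Var → Proc
  mu   : Var → Proc → Proc

infixl 6 _⊕_
infixl 5 _∥_

-- Substitution P[R/x] (capture-avoidance is not needed since only closed
-- terms μx.P of closed processes are ever substituted by the rules).
sub : Var → Proc → Proc → Proc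
sub x R nil        = nil
sub x R (act α P)  = act α (sub x R P)
sub x R (clk P)    = clk (sub x R P)
sub x R (P ⊕ Q)    = sub x R P ⊕ sub x R Q
sub x R (P ∥ Q)    = sub x R P ∥ sub x R Q
sub x R (res P L)  = res (sub x R P) L
sub x R (rel P f)  = rel (sub x R P) f
sub x R (var y)    = if x ≡ᵇ y then R else var y
sub x R (mu y P)   = if x ≡ᵇ y then mu y P else mu y (sub x R P)

data _—[_]⟶_ : Proc → Act → Proc → Set where
  pre   : ∀ {α P} → act α P —[ α ]⟶ P
  clkA  : ∀ {α P P'} → P —[ α ]⟶ P' → clk P —[ α ]⟶ P'
  sumL  : ∀ {α P Q P'} → P —[ α ]⟶ P' → (P ⊕ Q) —[ α ]⟶ P'
  sumR  : ∀ {α P Q Q'} → Q —[ α ]⟶ Q' → (P ⊕ Q) —[ α ]⟶ Q'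
  parL  : ∀ {α P Q P'} → P —[ α ]⟶ P' → (P ∥ Q) —[ α ]⟶ (P' ∥ Q)
  parR  : ∀ {α P Q Q'} → Q —[ α ]⟶ Q' → (P ∥ Q) —[ α ]⟶ (P ∥ Q')
  com   : ∀ {a P Q P' Q'} → Visible a → P —[ a ]⟶ P' → Q —[ compl a ]⟶ Q' →
          (P ∥ Q) —[ τ ]⟶ (P' ∥ Q')
  resA  : ∀ {α P P' L} → Allowed L α → P —[ α ]⟶ P' → res P L —[ α ]⟶ res P' L
  relA  : ∀ {α P P' f} → P —[ α ]⟶ P' → rel P f —[ relab f α ]⟶ rel P' f
  recA  : ∀ {α x P P'} → sub x (mu x P) P —[ α ]⟶ P' → mu x P —[ α ]⟶ P'

data Urgent : Act → Proc → Set where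
  u-pre  : ∀ {α P} → Urgent α (act α P)
  u-sumL : ∀ {α P Q} → Urgent α P → Urgent α (P ⊕ Q)
  u-sumR : ∀ {α P Q} → Urgent α Q → Urgent α (P ⊕ Q)
  u-parL : ∀ {α P Q} → Urgent α P → Urgent α (P ∥ Q)
  u-parR : ∀ {α P Q} → Urgent α Q → Urgent α (P ∥ Q)
  u-com  : ∀ {a P Q} → Visible a → Urgent a P → Urgent (compl a) Q →
           Urgent τ (P ∥ Q)
  u-res  : ∀ {α P L} → Allowed L α → Urgent α P → Urgent α (res P L)
  u-rel  : ∀ {α P f} → Urgent α P → Urgent (relab f α) (rel P f)
  u-rec  : ∀ {α x P} → Urgent α (sub x (mu x P) P) → Urgent α (mu x P)

data _—σ⟶₂_ : Proc → Proc → Set where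
  c-nil  : nil —σ⟶₂ nil
  c-pre  : ∀ {a P} → Visible a → act a P —σ⟶₂ act a P
  c-clk  : ∀ {P} → clk P —σ⟶₂ P
  c-clk' : ∀ {P P'} → P —σ⟶₂ P' → clk P —σ⟶₂ P'
  c-sum  : ∀ {P Q P' Q'} → P —σ⟶₂ P' → Q —σ⟶₂ Q' → (P ⊕ Q) —σ⟶₂ (P' ⊕ Q')
  c-par  : ∀ {P Q P' Q'} → P —σ⟶₂ P' → Q —σ⟶₂ Q' → ¬ Urgent τ (P ∥ Q) →
           (P ∥ Q) —σ⟶₂ (P' ∥ Q')
  c-res  : ∀ {P P' L} → P —σ⟶₂ P' → res P L —σ⟶₂ res P' L
  c-rel  : ∀ {P P' f} → P —σ⟶₂ P' → rel P f —σ⟶₂ rel P' f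
  c-rec  : ∀ {x P P'} → sub x (mu x P) P —σ⟶₂ P' → mu x P —σ⟶₂ P'

Is2Naive : Rel Proc 0ℓ → Set
Is2Naive R = ∀ {P Q} → R P Q →
    (∀ {α P'} → P —[ α ]⟶ P' → Σ Proc (λ Q' → (Q —[ α ]⟶ Q') × R P' Q'))
  × (∀ {α Q'} → Q —[ α ]⟶ Q' → Σ Proc (λ P' → (P —[ α ]⟶ P') × R P' Q'))
  × (∀ {P'} → P —σ⟶₂ P' → Σ Proc (λ Q' → (Q —σ⟶₂ Q') × R P' Q'))

_⊒2nv_ : Proc → Proc → Set₁
P ⊒2nv Q = Σ (Rel Proc 0ℓ) (λ R → Is2Naive R × R P Q)

Is2Indexed : (ℕ → Rel Proc 0ℓ) → Set
Is2Indexed R = ∀ {j P Q} → R j P Q →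
    (∀ {α P'} → P —[ α ]⟶ P' → Σ Proc (λ Q' → (Q —[ α ]⟶ Q') × R j P' Q'))
  × (∀ {α Q'} → Q —[ α ]⟶ Q' → Σ Proc (λ P' → (P —[ α ]⟶ P') × R j P' Q'))
  × (∀ {P'} → P —σ⟶₂ P' →
        Σ Proc (λ Q' → (Q —σ⟶₂ Q') × R j P' Q')
      ⊎ (Σ ℕ (λ k → (j ≡ suc k) × R k P' Q)))
  × (∀ {Q'} → Q —σ⟶₂ Q' →
        Σ Proc (λ P' → (P —σ⟶₂ P') × R j P' Q')
      ⊎ R (suc j) P Q')

_⊒[2,_]_ : Proc → ℕ → Proc → Set₁
P ⊒[2, j ] Q = Σ (ℕ → Rel Proc 0ℓ) (λ R → Is2Indexed R × R j P Q)

exP : Proc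
exP = act τ nil ∥ clk (clk (act τ nil))

exQ : Proc
exQ = clk (act τ nil) ∥ clk (clk (act τ nil))

-- At index 0 the clause letting the faster process run ahead cannot fire, so
-- R 0 of an indexed family is already a naive relation.  Conversely, exP has
-- an urgent τ and hence no clock step, so the naive preorder only has to match
-- actions, and the τ of exP is matched by the delayed τ of exQ.  An indexed
-- family must, however, also follow exQ idling to τ.0 | τ.0, which costs one
-- unit of index.  After the τ of exP, the remaining 0 | σ.σ.τ.0 offers two
-- clock ticks that the other side, blocked by an urgent τ, cannot match, and
-- each unmatched tick consumes one unit: one more than available.
module Submission where

open import Level using (0ℓ)
open import Data.Nat using (ℕ; suc)
open import Data.Product using (Σ; _×_; _,_)
open import Data.Sum using (_⊎_; inj₁; inj₂)
open import Data.Empty using (⊥; ⊥-elim)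
open import Relation.Nullary using (¬_)
open import Relation.Binary using (Rel)
open import Relation.Binary.PropositionalEquality using (_≡_; refl)

open import Defs

-- The equation α ≡ τ (rather than Urgent τ P) lets the relabelling case
-- split on α, since relab f α ≡ τ does not unify.
urgent-τ-blocks-σ : ∀ {α P P'} → Urgent α P → α ≡ τ → ¬ (P —σ⟶₂ P')
urgent-τ-blocks-σ u-pre             refl (c-pre ())
urgent-τ-blocks-σ (u-sumL u)        refl (c-sum s _)    = urgent-τ-blocks-σ u refl s
urgent-τ-blocks-σ (u-sumR u)        refl (c-sum _ s)    = urgent-τ-blocks-σ u refl s
urgent-τ-blocks-σ (u-parL u)        refl (c-par s _ _)  = urgent-τ-blocks-σ u refl s
urgent-τ-blocks-σ (u-parR u)        refl (c-par _ s _)  = urgent-τ-blocks-σ u refl s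
urgent-τ-blocks-σ (u-com v u u′)    refl (c-par _ _ ¬u) = ¬u (u-com v u u′)
urgent-τ-blocks-σ (u-res _ u)       refl (c-res s)      = urgent-τ-blocks-σ u refl s
urgent-τ-blocks-σ (u-rel {α = τ} u) refl (c-rel s)      = urgent-τ-blocks-σ u refl s
urgent-τ-blocks-σ (u-rec u)         refl (c-rec s)      = urgent-τ-blocks-σ u refl s

Idle : Proc → Set
Idle P = ∀ {α} → ¬ Urgent α P

idle-nil : Idle nil
idle-nil ()

idle-clk : ∀ {P} → Idle (clk P)
idle-clk ()

idle-∥ : ∀ {P Q} → Idle P → Idle Q → Idle (P ∥ Q)
idle-∥ iP iQ (u-parL u)    = iP u
idle-∥ iP iQ (u-parR u)    = iQ u
idle-∥ iP iQ (u-com _ u _) = iP u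

σ-∥-idle : ∀ {P Q P' Q'} → Idle P → Idle Q →
           P —σ⟶₂ P' → Q —σ⟶₂ Q' → (P ∥ Q) —σ⟶₂ (P' ∥ Q')
σ-∥-idle iP iQ s t = c-par s t (idle-∥ iP iQ)

σ-match-at-0 : ∀ {R : ℕ → Rel Proc 0ℓ} {P' Q} →
  Σ Proc (λ Q' → (Q —σ⟶₂ Q') × R 0 P' Q') ⊎ Σ ℕ (λ k → (0 ≡ suc k) × R k P' Q) →
  Σ Proc (λ Q' → (Q —σ⟶₂ Q') × R 0 P' Q')
σ-match-at-0 (inj₁ m)             = m
σ-match-at-0 (inj₂ (_ , () , _))

indexed⇒naive : ∀ {R} → Is2Indexed R → Is2Naive (R 0)
indexed⇒naive {R} isR r with isR r
... | fwd , bwd , σ-fwd , _ = fwd , bwd , λ s → σ-match-at-0 {R} (σ-fwd s)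

⊒[2,0]⇒⊒2nv : ∀ P Q → P ⊒[2, 0 ] Q → P ⊒2nv Q
⊒[2,0]⇒⊒2nv P Q (R , isR , r) = R 0 , indexed⇒naive isR , r

data τ-Ahead : Rel Proc 0ℓ where
  same    : ∀ {P} → τ-Ahead P P
  τ-first : ∀ {P X} → τ-Ahead (act τ P ∥ X) (clk (act τ P) ∥ X)

τ-Ahead-is2Naive : Is2Naive τ-Ahead
τ-Ahead-is2Naive same    = (λ t → _ , t , same) , (λ t → _ , t , same) , (λ s → _ , s , same)
τ-Ahead-is2Naive τ-first = fwd , bwd , λ s → ⊥-elim (urgent-τ-blocks-σ (u-parL u-pre) refl s)
  where
  fwd : ∀ {P X α P'} → (act τ P ∥ X) —[ α ]⟶ P' →
        Σ Proc (λ Q' → ((clk (act τ P) ∥ X) —[ α ]⟶ Q') × τ-Ahead P' Q')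
  fwd (parL pre) = _ , parL (clkA pre) , same
  fwd (parR t)   = _ , parR t , τ-first
  fwd (com () pre _)
  bwd : ∀ {P X α Q'} → (clk (act τ P) ∥ X) —[ α ]⟶ Q' →
        Σ Proc (λ P' → ((act τ P ∥ X) —[ α ]⟶ P') × τ-Ahead P' Q')
  bwd (parL (clkA pre)) = _ , parL pre , same
  bwd (parR t)          = _ , parR t , τ-first
  bwd (com () (clkA pre) _)

τ∥-⊒2nv-στ∥ : ∀ P X → (act τ P ∥ X) ⊒2nv (clk (act τ P) ∥ X)
τ∥-⊒2nv-στ∥ P X = τ-Ahead , τ-Ahead-is2Naive , τ-first

module _ {R : ℕ → Rel Proc 0ℓ} (isR : Is2Indexed R) where

  match-action : ∀ {j α P P' Q} → R j P Q → P —[ α ]⟶ P' →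
                 Σ Proc (λ Q' → (Q —[ α ]⟶ Q') × R j P' Q')
  match-action r with fwd , _ ← isR r = fwd

  fast-σ-against-urgent : ∀ {j P P' Q} → R j P Q → Urgent τ Q → P —σ⟶₂ P' →
                          Σ ℕ (λ k → (j ≡ suc k) × R k P' Q)
  fast-σ-against-urgent r u s with isR r
  ... | _ , _ , σ-fwd , _ with σ-fwd s
  ...   | inj₁ (_ , t , _) = ⊥-elim (urgent-τ-blocks-σ u refl t)
  ...   | inj₂ m           = m

  slow-σ-against-urgent : ∀ {j P Q Q'} → R j P Q → Urgent τ P → Q —σ⟶₂ Q' →
                          R (suc j) P Q'
  slow-σ-against-urgent r u t with isR r
  ... | _ , _ , _ , σ-bwd with σ-bwd t
  ...   | inj₁ (_ , s , _) = ⊥-elim (urgent-τ-blocks-σ u refl s)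
  ...   | inj₂ r′           = r′

τ∥τ-τ-derivative-urgent : ∀ {P P' Q} → (act τ P ∥ act τ P') —[ τ ]⟶ Q → Urgent τ Q
τ∥τ-τ-derivative-urgent (parL pre) = u-parR u-pre
τ∥τ-τ-derivative-urgent (parR pre) = u-parL u-pre
τ∥τ-τ-derivative-urgent (com () pre _)

σ-nil∥clk : ∀ {P} → (nil ∥ clk P) —σ⟶₂ (nil ∥ P)
σ-nil∥clk = σ-∥-idle idle-nil idle-clk c-nil c-clk

exP⋣[2,0]exQ : ¬ (exP ⊒[2, 0 ] exQ)
exP⋣[2,0]exQ (R , isR , r₀) = after-τ (match-action isR r₁ (parL pre))
  where
  r₁ : R 1 exP (act τ nil ∥ act τ nil)
  r₁ = slow-σ-against-urgent isR r₀ (u-parL u-pre)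
         (σ-∥-idle idle-clk idle-clk c-clk (c-clk' c-clk))

  after-τ : Σ Proc (λ Q → ((act τ nil ∥ act τ nil) —[ τ ]⟶ Q)
                        × R 1 (nil ∥ clk (clk (act τ nil))) Q) → ⊥
  after-τ (_ , t , r)
    with _ , refl , r′ ← fast-σ-against-urgent isR r (τ∥τ-τ-derivative-urgent t) σ-nil∥clk
    with _ , () , _ ← fast-σ-against-urgent isR r′ (τ∥τ-τ-derivative-urgent t) σ-nil∥clk

mainTheorem5 : (∀ P Q → P ⊒[2, 0 ] Q → P ⊒2nv Q)
             × ¬ (∀ P Q → P ⊒2nv Q → P ⊒[2, 0 ] Q)
             × (exP ⊒2nv exQ)
             × ¬ (exP ⊒[2, 0 ] exQ)
mainTheorem5 = ⊒[2,0]⇒⊒2nv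
             , (λ converse → exP⋣[2,0]exQ (converse exP exQ exP⊒2nvexQ))
             , exP⊒2nvexQ
             , exP⋣[2,0]exQ
  where
  exP⊒2nvexQ : exP ⊒2nv exQ
  exP⊒2nvexQ = τ∥-⊒2nv-στ∥ nil (clk (clk (act τ nil)))
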